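{- Let $k\geq 2$ be even, $1\leq x\leq k-1$, $n=k+x$, with $(x,n)\notin\{(1,4),(1,6)\}$. Then $\lambda^k(\overrightarrow{C_n})\geq x+1$.
   Context: $\overrightarrow{C_n}$ is the directed cycle (circuit) on $n$ vertices and $\overleftrightarrow{K_n}$ the complete digraph on $n$ vertices (all arcs $(u,v)$, $u\ne v$). A $p$-labeled packing of $k$ copies of $\overrightarrow{C_n}$ is a map $f$ from $V(\overleftrightarrow{K_n})$ onto a set of exactly $p$ labels together with injections $\sigma_1,\dots,\sigma_k:V(\overrightarrow{C_n})\to V(\overleftrightarrow{K_n})$ such that for $i\neq j$ the induced arc images are disjoint, and for every vertex $v$, $f(\sigma_1(v))=\dots=f(\sigma_k(v))$. $\lambda^k(\overrightarrow{C_n})$ is the largest $p$ for which such a packing exists. -}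

module Defs where

open import Data.Nat using (ℕ; suc; _∸_)
open import Data.Fin using (Fin; toℕ)
open import Data.Product using (_×_)
open import Data.Sum using (_⊎_)
open import Data.Empty using (⊥)
open import Relation.Binary.PropositionalEquality using (_≡_; _≢_)
open import Function.Definitions using (Injective; Surjective)

CycleArc : (n : ℕ) → Fin n → Fin n → Set
CycleArc n a b = (toℕ b ≡ suc (toℕ a)) ⊎ ((toℕ a ≡ n ∸ 1) × (toℕ b ≡ 0))

-- Vertices of the complete digraph K_n are also Fin n (all arcs u ≠ v
-- are present, so any injection maps arcs of C_n to arcs of K_n).
-- A p-labeled packing of k copies of C_n into K_n.
record LabeledPacking (n k p : ℕ) : Set where
  field
    label        : Fin n → Fin p
    label-onto   : Surjective _≡_ _≡_ label
    σ            : Fin k → Fin n → Fin n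
    σ-injective  : ∀ i → Injective _≡_ _≡_ (σ i)
    arcs-disjoint : ∀ i j → i ≢ j → ∀ a b c d →
                    CycleArc n a b → CycleArc n c d →
                    σ i a ≡ σ j c → σ i b ≡ σ j d → ⊥
    label-fixed  : ∀ i j v → label (σ i v) ≡ label (σ j v)

-- Along C_n place x pairwise non-adjacent "fixed" vertices F_t and k "rotating"
-- vertices Z_0, …, Z_{k-1} in this order.  Copy i sends F_t to k + t and Z_s to
-- g(s) + i mod k, where g is the zigzag ordering -1, 0, -2, 1, -3, 2, … of ℤ_k;
-- the vertices 0, …, k-1 of K_n share one label and k, …, k+x-1 get one label
-- each, giving x + 1 labels.  Two copies cannot share an arc touching a fixed
-- vertex, because the rotating end of such an arc is moved by every shift.  An
-- arc Z_s → Z_{s+1} has difference g(s+1) - g(s) ≡ (-1)^s (s+1), and these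
-- differences are pairwise distinct modulo k precisely because k is even.

module Submission where

open import Defs
open import Data.Nat
open import Data.Nat.Properties
open import Data.Nat.DivMod
open import Data.Nat.Divisibility using (_∣_; divides; n∣m*n)
open import Data.Nat.Solver using (module +-*-Solver)
open import Data.Fin using (Fin; toℕ; fromℕ<; zero; suc; splitAt; _↑ʳ_)
open import Data.Fin.Properties using (toℕ-injective; toℕ-fromℕ<; toℕ<n; splitAt-<; splitAt-↑ʳ)
open import Data.Sum using (inj₁; inj₂; [_,_]′)
open import Data.Product using (_×_; _,_; ∃-syntax)
open import Data.Empty using (⊥; ⊥-elim)
open import Function using (const; _∘_)
open import Function.Definitions using (Injective; Surjective)
open import Relation.Nullary using (¬_)
open import Relation.Binary.PropositionalEquality

open import Algebra.Properties.CommutativeSemigroup +-commutativeSemigroup using (xy∙z≈xz∙y)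

open +-*-Solver using (solve; _:+_; _:*_; _:=_; con)

module _ {k : ℕ} .{{_ : NonZero k}} where

  %-cong-+ʳ : ∀ {a b} c → a % k ≡ b % k → (a + c) % k ≡ (b + c) % k
  %-cong-+ʳ {a} {b} c eq = begin
    (a + c) % k          ≡⟨ %-distribˡ-+ a c k ⟩
    (a % k + c % k) % k  ≡⟨ cong (λ r → (r + c % k) % k) eq ⟩
    (b % k + c % k) % k  ≡⟨ %-distribˡ-+ b c k ⟨
    (b + c) % k          ∎
    where open ≡-Reasoning

  +-cancelˡ-% : ∀ c {a b} → (c + a) % k ≡ (c + b) % k → a % k ≡ b % k
  +-cancelˡ-% c {a} {b} eq = begin
    a % k                        ≡⟨ %-remove-+ʳ a (n∣m*n c) ⟨
    (a + c * k) % k              ≡⟨ %-congˡ (absorb a) ⟩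
    (c + a + c * pred k) % k     ≡⟨ %-cong-+ʳ (c * pred k) eq ⟩
    (c + b + c * pred k) % k     ≡⟨ %-congˡ (absorb b) ⟨
    (b + c * k) % k              ≡⟨ %-remove-+ʳ b (n∣m*n c) ⟩
    b % k                        ∎
    where
    open ≡-Reasoning
    absorb : ∀ a → a + c * k ≡ c + a + c * pred k
    absorb a = begin
      a + c * k                ≡⟨ cong (λ m → a + c * m) (suc-pred k) ⟨
      a + c * suc (pred k)     ≡⟨ solve 3 (λ a c p → a :+ c :* (con 1 :+ p) := c :+ a :+ c :* p) refl a c (pred k) ⟩
      c + a + c * pred k       ∎

  +-cancel-% : ∀ {a b c d} → a % k ≡ b % k → (a + c) % k ≡ (b + d) % k → c % k ≡ d % k
  +-cancel-% {a} {b} {c} {d} ab eq = +-cancelˡ-% a (trans eq (%-cong-+ʳ d (sym ab)))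

  +-cancelʳ-% : ∀ c {a b} → (a + c) % k ≡ (b + c) % k → a % k ≡ b % k
  +-cancelʳ-% c {a} {b} eq = +-cancelˡ-% c (trans (%-congˡ (+-comm c a)) (trans eq (%-congˡ (+-comm b c))))

  %-injective-< : ∀ {a b} → a < k → b < k → a % k ≡ b % k → a ≡ b
  %-injective-< a<k b<k eq = trans (sym (m<n⇒m%n≡m a<k)) (trans eq (m<n⇒m%n≡m b<k))

  rotation-injective : ∀ u {i j} → i < k → j < k → (u + i) % k ≡ (u + j) % k → i ≡ j
  rotation-injective u i<k j<k eq = %-injective-< i<k j<k (+-cancelˡ-% u eq)

suc-last : ∀ {n} (a : Fin n) → toℕ a ≡ n ∸ 1 → suc (toℕ a) ≡ n
suc-last {suc n} a eq = cong suc eq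

successor-unique : ∀ {n} {a b d : Fin n} → CycleArc n a b → CycleArc n a d → b ≡ d
successor-unique (inj₁ b≡) (inj₁ d≡) = toℕ-injective (trans b≡ (sym d≡))
successor-unique {a = a} {b = b} (inj₁ b≡) (inj₂ (a≡ , _)) =
  ⊥-elim (<-irrefl (trans b≡ (suc-last a a≡)) (toℕ<n b))
successor-unique {a = a} {d = d} (inj₂ (a≡ , _)) (inj₁ d≡) =
  ⊥-elim (<-irrefl (trans d≡ (suc-last a a≡)) (toℕ<n d))
successor-unique (inj₂ (_ , b≡0)) (inj₂ (_ , d≡0)) = toℕ-injective (trans b≡0 (sym d≡0))

predecessor-unique : ∀ {n} {a b c : Fin n} → CycleArc n a b → CycleArc n c b → a ≡ c
predecessor-unique (inj₁ b≡) (inj₁ b≡′) = toℕ-injective (suc-injective (trans (sym b≡) b≡′))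
predecessor-unique (inj₁ b≡) (inj₂ (_ , b≡0)) with () ← trans (sym b≡) b≡0
predecessor-unique (inj₂ (_ , b≡0)) (inj₁ b≡) with () ← trans (sym b≡) b≡0
predecessor-unique (inj₂ (a≡ , _)) (inj₂ (c≡ , _)) = toℕ-injective (trans a≡ (sym c≡))

data Slot : Set where
  rotating fixed : ℕ → Slot

shift : Slot → Slot
shift (rotating s) = rotating (suc s)
shift (fixed t)    = fixed (suc t)

-- slot x p is the p-th vertex of the cycle F_0 Z_0 F_1 Z_1 … F_{x-1} Z_{x-1} Z_x … Z_{k-1}.
slot : ℕ → ℕ → Slot
slot zero    p                   = rotating p
slot (suc x) zero                = fixed 0
slot (suc x) (suc zero)          = rotating 0
slot (suc x) (suc (suc p))       = shift (slot x p)

position : ℕ → Slot → ℕ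
position x       (fixed t)           = t + t
position zero    (rotating s)        = s
position (suc x) (rotating zero)     = 1
position (suc x) (rotating (suc s))  = suc (suc (position x (rotating s)))

position-shift : ∀ x σ → position (suc x) (shift σ) ≡ suc (suc (position x σ))
position-shift x (rotating s) = refl
position-shift x (fixed t)    = cong suc (+-suc t t)

position-slot : ∀ x p → position x (slot x p) ≡ p
position-slot zero    p             = refl
position-slot (suc x) zero          = refl
position-slot (suc x) (suc zero)    = refl
position-slot (suc x) (suc (suc p)) =
  trans (position-shift x (slot x p)) (cong (λ q → suc (suc q)) (position-slot x p))

slot-injective : ∀ x {p q} → slot x p ≡ slot x q → p ≡ q
slot-injective x {p} {q} eq =
  trans (sym (position-slot x p)) (trans (cong (position x) eq) (position-slot x q))

slot-odd : ∀ {x t} → t < x → slot x (suc (t + t)) ≡ rotating t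
slot-odd {suc x} {zero}  _         = refl
slot-odd {suc x} {suc t} (s≤s t<x) rewrite +-suc t t = cong shift (slot-odd t<x)

rotating-step : ∀ x p {s u} → slot x p ≡ rotating s → slot x (suc p) ≡ rotating u → u ≡ suc s
rotating-step zero          p             refl refl = refl
rotating-step (suc zero)    (suc zero)    refl refl = refl
rotating-step (suc (suc x)) (suc zero)    _    ()
rotating-step (suc x)       (suc (suc p)) e    e′
  with slot x p in σ | slot x (suc p) in τ | e | e′
... | rotating _ | rotating _ | refl | refl = cong suc (rotating-step x p σ τ)

slot-start : ∀ {x} → 0 < x → slot x 0 ≡ fixed 0
slot-start {suc x} _ = refl

InRange : ℕ → ℕ → Slot → Set
InRange k x (rotating s) = s < k
InRange k x (fixed t)    = t < x

shift-inRange : ∀ {k x} σ → InRange k x σ → InRange (suc k) (suc x) (shift σ)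
shift-inRange (rotating s) = s≤s
shift-inRange (fixed t)    = s≤s

slot-inRange : ∀ x {k p} → x ≤ k → p < k + x → InRange k x (slot x p)
slot-inRange zero    {k} {p}  _         p<k = subst (p <_) (+-identityʳ k) p<k
slot-inRange (suc x) {k} {zero} _       _   = z<s
slot-inRange (suc x) {suc k} {suc zero} _ _ = z<s
slot-inRange (suc x) {suc k} {suc (suc p)} (s≤s x≤k) (s≤s p<) =
  shift-inRange (slot x p) (slot-inRange x x≤k (≤-pred (subst (suc (suc p) ≤_) (+-suc k x) p<)))

slot-fixed-suc< : ∀ {x k p t} → x ≤ k → p < k + x → slot x p ≡ fixed t → suc p < k + x
slot-fixed-suc< {x} {k} {p} {t} x≤k p<n eq = begin-strict
  suc p               ≡⟨ cong suc (trans (sym (position-slot x p)) (cong (position x) eq)) ⟩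
  suc (t + t)         <⟨ n<1+n _ ⟩
  suc (suc (t + t))   ≡⟨ cong suc (+-suc t t) ⟨
  suc t + suc t       ≤⟨ +-mono-≤ t<x t<x ⟩
  x + x               ≤⟨ +-monoˡ-≤ x x≤k ⟩
  k + x               ∎
  where
  open ≤-Reasoning
  t<x : t < x
  t<x = subst (InRange k x) eq (slot-inRange x x≤k p<n)

record Sequencing (k : ℕ) .{{_ : NonZero k}} : Set where
  field
    term           : ℕ → ℕ
    gap            : ℕ → ℕ
    term<          : ∀ {s} → s < k → term s < k
    term-injective : ∀ {s s′} → s < k → s′ < k → term s ≡ term s′ → s ≡ s′
    gap<           : ∀ {s} → suc s < k → gap s < k
    gap-injective  : ∀ {s s′} → suc s < k → suc s′ < k → gap s ≡ gap s′ → s ≡ s′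
    term-suc       : ∀ {s} → suc s < k → (term s + gap s) % k ≡ term (suc s) % k

  term-suc-translate : ∀ {s} i → suc s < k → (term (suc s) + i) % k ≡ (term s + i + gap s) % k
  term-suc-translate {s} i s<k = begin
    (term (suc s) + i) % k    ≡⟨ %-cong-+ʳ i (term-suc s<k) ⟨
    (term s + gap s + i) % k  ≡⟨ %-congˡ (xy∙z≈xz∙y (term s) (gap s) i) ⟩
    (term s + i + gap s) % k  ∎
    where open ≡-Reasoning

  consecutive-unique : ∀ {s s′ i j} → suc s < k → suc s′ < k →
    (term s + i) % k ≡ (term s′ + j) % k →
    (term (suc s) + i) % k ≡ (term (suc s′) + j) % k → s ≡ s′
  consecutive-unique {s} {s′} {i} {j} s<k s′<k e₁ e₂ =
    gap-injective s<k s′<k (%-injective-< (gap< s<k) (gap< s′<k) (+-cancel-% e₁ gaps))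
    where
    gaps : (term s + i + gap s) % k ≡ (term s′ + j + gap s′) % k
    gaps = trans (sym (term-suc-translate i s<k)) (trans e₂ (term-suc-translate j s′<k))

data EvenOdd : ℕ → Set where
  even : ∀ a → EvenOdd (a + a)
  odd  : ∀ a → EvenOdd (suc (a + a))

evenOdd : ∀ s → EvenOdd s
evenOdd zero          = even 0
evenOdd (suc zero)    = odd 0
evenOdd (suc (suc s)) with evenOdd s
... | even a = subst EvenOdd (cong suc (+-suc a a)) (even (suc a))
... | odd a  = subst EvenOdd (cong (λ m → suc (suc m)) (+-suc a a)) (odd (suc a))

double-injective : ∀ {a b} → a + a ≡ b + b → a ≡ b
double-injective {a} {b} eq = trans (n≡⌊n+n/2⌋ a) (trans (cong ⌊_/2⌋ eq) (sym (n≡⌊n+n/2⌋ b)))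

odd≢double : ∀ a b → suc (a + a) ≢ b + b
odd≢double a b eq = even≢odd b a (begin
  b + (b + 0)        ≡⟨ cong (b +_) (+-identityʳ b) ⟩
  b + b              ≡⟨ eq ⟨
  suc (a + a)        ≡⟨ cong (λ c → suc (a + c)) (+-identityʳ a) ⟨
  suc (a + (a + 0))  ∎)
  where open ≡-Reasoning

double-cancel-< : ∀ {a b} → a + a < b + b → a < b
double-cancel-< lt = ≰⇒> (λ b≤a → <⇒≱ lt (+-mono-≤ b≤a b≤a))

odd-cancel-< : ∀ {a b} → suc (a + a) < b + b → a < b
odd-cancel-< lt = double-cancel-< (<-trans (n<1+n _) lt)

interleave : {A : Set} → (ℕ → A) → (ℕ → A) → ℕ → A
interleave f g zero          = f 0
interleave f g (suc zero)    = g 0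
interleave f g (suc (suc s)) = interleave (f ∘ suc) (g ∘ suc) s

interleave-even : ∀ {A : Set} (f g : ℕ → A) a → interleave f g (a + a) ≡ f a
interleave-even f g zero    = refl
interleave-even f g (suc a) rewrite +-suc a a = interleave-even (f ∘ suc) (g ∘ suc) a

interleave-odd : ∀ {A : Set} (f g : ℕ → A) a → interleave f g (suc (a + a)) ≡ g a
interleave-odd f g zero    = refl
interleave-odd f g (suc a) rewrite +-suc a a = interleave-odd (f ∘ suc) (g ∘ suc) a

module Zigzag (h′ : ℕ) where

  h : ℕ
  h = suc h′

  mirror : ℕ → ℕ
  mirror a = h ∸ suc a

  mirror< : ∀ a → mirror a < h
  mirror< a = s≤s (m∸n≤m h′ a)

  mirror+suc : ∀ {a} → a < h → mirror a + suc a ≡ h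
  mirror+suc = m∸n+n≡m

  mirror-injective : ∀ {a b} → a < h → b < h → mirror a ≡ mirror b → a ≡ b
  mirror-injective a<h b<h eq = suc-injective (∸-cancelˡ-≡ a<h b<h eq)

  mirror-suc : ∀ {a} → suc a < h → mirror a ≡ suc (mirror (suc a))
  mirror-suc (s≤s a<h′) = +-∸-assoc 1 a<h′

  -- In ℤ_{2h}: term = -1, 0, -2, 1, -3, 2, … and gap = 1, -2, 3, -4, …
  term gap : ℕ → ℕ
  term = interleave (λ a → h + mirror a) (λ a → a)
  gap  = interleave (λ a → suc (a + a)) (λ a → mirror a + mirror a)

  term-even : ∀ a → term (a + a) ≡ h + mirror a
  term-even = interleave-even _ _

  term-odd : ∀ a → term (suc (a + a)) ≡ a
  term-odd = interleave-odd _ _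

  term-next-even : ∀ a → term (suc (suc (a + a))) ≡ h + mirror (suc a)
  term-next-even = interleave-even _ _

  gap-even : ∀ a → gap (a + a) ≡ suc (a + a)
  gap-even = interleave-even _ _

  gap-odd : ∀ a → gap (suc (a + a)) ≡ mirror a + mirror a
  gap-odd = interleave-odd _ _

  term< : ∀ {s} → s < h + h → term s < h + h
  term< {s} s<k with evenOdd s
  ... | even a = subst (_< h + h) (sym (term-even a)) (+-monoʳ-< h (mirror< a))
  ... | odd a  = subst (_< h + h) (sym (term-odd a)) (<-trans (odd-cancel-< s<k) (m<m+n h z<s))

  upper≢lower : ∀ a {b} → b < h → h + mirror a ≢ b
  upper≢lower a b<h eq = <⇒≱ b<h (subst (h ≤_) eq (m≤m+n h (mirror a)))

  term-injective : ∀ {s s′} → s < h + h → s′ < h + h → term s ≡ term s′ → s ≡ s′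
  term-injective {s} {s′} s<k s′<k eq with evenOdd s | evenOdd s′
  ... | even a | even b =
    cong (λ c → c + c) (mirror-injective {a} {b} (double-cancel-< s<k) (double-cancel-< s′<k)
      (+-cancelˡ-≡ h _ _ (trans (sym (term-even a)) (trans eq (term-even b)))))
  ... | odd a  | odd b  = cong (λ c → suc (c + c)) (trans (sym (term-odd a)) (trans eq (term-odd b)))
  ... | even a | odd b  =
    ⊥-elim (upper≢lower a (odd-cancel-< {b} s′<k) (trans (sym (term-even a)) (trans eq (term-odd b))))
  ... | odd a  | even b =
    ⊥-elim (upper≢lower b (odd-cancel-< {a} s<k) (trans (sym (term-even b)) (trans (sym eq) (term-odd a))))

  gap< : ∀ {s} → suc s < h + h → gap s < h + h
  gap< {s} s<k with evenOdd s
  ... | even a = subst (_< h + h) (sym (gap-even a)) s<k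
  ... | odd a  = subst (_< h + h) (sym (gap-odd a)) (+-mono-< (mirror< a) (mirror< a))

  gap-injective : ∀ {s s′} → suc s < h + h → suc s′ < h + h → gap s ≡ gap s′ → s ≡ s′
  gap-injective {s} {s′} s<k s′<k eq with evenOdd s | evenOdd s′
  ... | even a | even b = suc-injective (trans (sym (gap-even a)) (trans eq (gap-even b)))
  ... | odd a  | odd b  =
    cong (λ c → suc (c + c)) (mirror-injective {a} {b}
      (odd-cancel-< (<-trans (n<1+n _) s<k)) (odd-cancel-< (<-trans (n<1+n _) s′<k))
      (double-injective (trans (sym (gap-odd a)) (trans eq (gap-odd b)))))
  ... | even a | odd b  = ⊥-elim (odd≢double a (mirror b) (trans (sym (gap-even a)) (trans eq (gap-odd b))))
  ... | odd a  | even b = ⊥-elim (odd≢double b (mirror a) (trans (sym (gap-even b)) (trans (sym eq) (gap-odd a))))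

  term-suc : ∀ {s} → suc s < h + h → (term s + gap s) % (h + h) ≡ term (suc s) % (h + h)
  term-suc {s} s<k with evenOdd s
  ... | even a = begin
    (term (a + a) + gap (a + a)) % (h + h)  ≡⟨ cong₂ (λ u v → (u + v) % (h + h)) (term-even a) (gap-even a) ⟩
    (h + mirror a + suc (a + a)) % (h + h)  ≡⟨ %-congˡ (solve 3 (λ h m a → h :+ m :+ (con 1 :+ a :+ a) := a :+ (h :+ (m :+ (con 1 :+ a)))) refl h (mirror a) a) ⟩
    (a + (h + (mirror a + suc a))) % (h + h) ≡⟨ cong (λ z → (a + (h + z)) % (h + h)) (mirror+suc (odd-cancel-< s<k)) ⟩
    (a + (h + h)) % (h + h)                 ≡⟨ [m+n]%n≡m%n a (h + h) ⟩
    a % (h + h)                             ≡⟨ cong (_% (h + h)) (term-odd a) ⟨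
    term (suc (a + a)) % (h + h)            ∎
    where open ≡-Reasoning
  ... | odd a = cong (_% (h + h)) (begin
    term (suc (a + a)) + gap (suc (a + a))  ≡⟨ cong₂ _+_ (term-odd a) (gap-odd a) ⟩
    a + (mirror a + mirror a)               ≡⟨ cong (λ m → a + (m + m)) (mirror-suc sa<h) ⟩
    a + (suc m′ + suc m′)                   ≡⟨ solve 2 (λ a m → a :+ ((con 1 :+ m) :+ (con 1 :+ m)) := m :+ (con 2 :+ a) :+ m) refl a m′ ⟩
    m′ + suc (suc a) + m′                   ≡⟨ cong (_+ m′) (mirror+suc sa<h) ⟩
    h + m′                                  ≡⟨ term-next-even a ⟨
    term (suc (suc (a + a)))                ∎)
    where
    open ≡-Reasoning
    m′ : ℕ
    m′ = mirror (suc a)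
    sa<h : suc a < h
    sa<h = double-cancel-< (subst (_< h + h) (cong suc (sym (+-suc a a))) s<k)

  zigzag : Sequencing (h + h)
  zigzag = record
    { term = term ; gap = gap ; term< = term< ; term-injective = term-injective
    ; gap< = gap< ; gap-injective = gap-injective ; term-suc = term-suc }

module Packing {k : ℕ} .{{_ : NonZero k}} (S : Sequencing k) {x : ℕ} (0<x : 0 < x) (x≤k : x ≤ k) where

  open Sequencing S

  layout : Fin (k + x) → Slot
  layout p = slot x (toℕ p)

  layout-inRange : ∀ p → InRange k x (layout p)
  layout-inRange p = slot-inRange x x≤k (toℕ<n p)

  layout-injective : ∀ {p q} → layout p ≡ layout q → p ≡ q
  layout-injective eq = toℕ-injective (slot-injective x eq)

  after-fixed : ∀ {a b t} → CycleArc (k + x) a b → layout a ≡ fixed t → layout b ≡ rotating t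
  after-fixed {a} (inj₁ b≡) eq =
    trans (cong (slot x) (trans b≡ (cong suc (trans (sym (position-slot x (toℕ a))) (cong (position x) eq)))))
          (slot-odd (subst (InRange k x) eq (layout-inRange a)))
  after-fixed {a} (inj₂ (a≡ , _)) eq =
    ⊥-elim (<-irrefl (suc-last a a≡) (slot-fixed-suc< x≤k (toℕ<n a) eq))

  after-rotating : ∀ {a b s u} → CycleArc (k + x) a b → layout a ≡ rotating s → layout b ≡ rotating u → u ≡ suc s
  after-rotating {a} (inj₁ b≡) ea eb = rotating-step x (toℕ a) ea (trans (cong (slot x) (sym b≡)) eb)
  after-rotating (inj₂ (_ , b≡0)) ea eb
    with () ← trans (sym (slot-start 0<x)) (trans (cong (slot x) (sym b≡0)) eb)

  rotating-bound : ∀ {v s} → layout v ≡ rotating s → s < k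
  rotating-bound {v} eq = subst (InRange k x) eq (layout-inRange v)

  place : ℕ → Slot → ℕ
  place i (rotating s) = (term s + i) % k
  place i (fixed t)    = k + t

  place< : ∀ i σ → InRange k x σ → place i σ < k + x
  place< i (rotating s) _   = <-≤-trans (m%n<n _ k) (m≤m+n k x)
  place< i (fixed t)    t<x = +-monoʳ-< k t<x

  place-fixed : ∀ {i t} σ → place i σ ≡ k + t → σ ≡ fixed t
  place-fixed (rotating s) eq = ⊥-elim (<⇒≱ (m%n<n _ k) (subst (k ≤_) (sym eq) (m≤m+n k _)))
  place-fixed (fixed t)    eq = cong fixed (+-cancelˡ-≡ k _ _ eq)

  place-rotating : ∀ {i j s} τ → place i (rotating s) ≡ place j τ → ∃[ s′ ] τ ≡ rotating s′
  place-rotating (rotating s′) _ = s′ , refl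
  place-rotating (fixed t) eq with () ← place-fixed (rotating _) eq

  place-injective : ∀ i σ τ → InRange k x σ → InRange k x τ → place i σ ≡ place i τ → σ ≡ τ
  place-injective i (rotating s) (rotating s′) s<k s′<k eq =
    cong rotating (term-injective s<k s′<k (%-injective-< (term< s<k) (term< s′<k) (+-cancelʳ-% i eq)))
  place-injective i σ (fixed t) _ _ eq = place-fixed σ eq
  place-injective i (fixed t) (rotating s) _ _ eq = sym (place-fixed (rotating s) (sym eq))

  rotating-separates-copies : ∀ {i j v s} → i < k → j < k → layout v ≡ rotating s →
    place i (layout v) ≡ place j (layout v) → i ≡ j
  rotating-separates-copies {i} {j} {s = s} i<k j<k eq e =
    rotation-injective (term s) i<k j<k (subst (λ σ → place i σ ≡ place j σ) eq e)

  private variable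
    i j s t : ℕ
    a b c d : Fin (k + x)

  shared-arc-from-fixed : i < k → j < k → CycleArc (k + x) a b → CycleArc (k + x) c d →
    k + t ≡ place j (layout c) → place i (layout b) ≡ place j (layout d) →
    layout a ≡ fixed t → i ≡ j
  shared-arc-from-fixed {c = c} i<k j<k ab cd e₁ e₂ ea
    with refl ← layout-injective (trans ea (sym (place-fixed (layout c) (sym e₁))))
    with refl ← successor-unique ab cd
    = rotating-separates-copies i<k j<k (after-fixed ab ea) e₂

  shared-arc-into-fixed : i < k → j < k → CycleArc (k + x) a b → CycleArc (k + x) c d →
    place i (rotating s) ≡ place j (layout c) → k + t ≡ place j (layout d) →
    layout a ≡ rotating s → layout b ≡ fixed t → i ≡ j
  shared-arc-into-fixed {d = d} i<k j<k ab cd e₁ e₂ ea eb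
    with refl ← layout-injective (trans eb (sym (place-fixed (layout d) (sym e₂))))
    with refl ← predecessor-unique ab cd
    = rotating-separates-copies i<k j<k ea (trans (cong (place _) ea) e₁)

  shared-arc-rotating : i < k → j < k → CycleArc (k + x) a b → CycleArc (k + x) c d →
    place i (rotating s) ≡ place j (layout c) → place i (rotating t) ≡ place j (layout d) →
    layout a ≡ rotating s → layout b ≡ rotating t → i ≡ j
  shared-arc-rotating {j = j} {c = c} {d = d} {s} i<k j<k ab cd e₁ e₂ ea eb
    with refl ← after-rotating ab ea eb
    with (_ , ec) ← place-rotating (layout c) e₁ | (_ , ed) ← place-rotating (layout d) e₂
    with refl ← after-rotating cd ec ed
    with refl ← consecutive-unique (rotating-bound eb) (rotating-bound ed)
                  (trans e₁ (cong (place j) ec)) (trans e₂ (cong (place j) ed))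
    = rotation-injective (term s) i<k j<k (trans e₁ (cong (place j) ec))

  shared-arc⇒same-copy : i < k → j < k → CycleArc (k + x) a b → CycleArc (k + x) c d →
    place i (layout a) ≡ place j (layout c) → place i (layout b) ≡ place j (layout d) → i ≡ j
  shared-arc⇒same-copy {a = a} {b = b} i<k j<k ab cd e₁ e₂ with layout a in ea
  ... | fixed _ = shared-arc-from-fixed i<k j<k ab cd e₁ e₂ ea
  ... | rotating _ with layout b in eb
  ...   | fixed _    = shared-arc-into-fixed i<k j<k ab cd e₁ e₂ ea eb
  ...   | rotating _ = shared-arc-rotating i<k j<k ab cd e₁ e₂ ea eb

  copy : Fin k → Fin (k + x) → Fin (k + x)
  copy i p = fromℕ< (place< (toℕ i) (layout p) (layout-inRange p))

  toℕ-copy : ∀ i p → toℕ (copy i p) ≡ place (toℕ i) (layout p)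
  toℕ-copy i p = toℕ-fromℕ< _

  copy-injective : ∀ i → Injective _≡_ _≡_ (copy i)
  copy-injective i {p} {q} eq = layout-injective
    (place-injective (toℕ i) _ _ (layout-inRange p) (layout-inRange q)
      (trans (sym (toℕ-copy i p)) (trans (cong toℕ eq) (toℕ-copy i q))))

  copies-arc-disjoint : ∀ i j → i ≢ j → ∀ a b c d → CycleArc (k + x) a b → CycleArc (k + x) c d →
                        copy i a ≡ copy j c → copy i b ≡ copy j d → ⊥
  copies-arc-disjoint i j i≢j a b c d ab cd e₁ e₂ = i≢j (toℕ-injective
    (shared-arc⇒same-copy (toℕ<n i) (toℕ<n j) ab cd (on-toℕ e₁) (on-toℕ e₂)))
    where
    on-toℕ : ∀ {p q} → copy i p ≡ copy j q → place (toℕ i) (layout p) ≡ place (toℕ j) (layout q)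
    on-toℕ {p} {q} eq = trans (sym (toℕ-copy i p)) (trans (cong toℕ eq) (toℕ-copy j q))

  label : Fin (k + x) → Fin (suc x)
  label v = [ const zero , suc ]′ (splitAt k v)

  label-< : ∀ v → toℕ v < k → label v ≡ zero
  label-< v v<k = cong [ const zero , suc ]′ (splitAt-< k v v<k)

  label-onto : Surjective _≡_ _≡_ label
  label-onto zero    = fromℕ< 0<n , λ { refl → label-< _ (subst (_< k) (sym (toℕ-fromℕ< 0<n)) (>-nonZero⁻¹ k)) }
    where
    0<n : 0 < k + x
    0<n = <-≤-trans (>-nonZero⁻¹ k) (m≤m+n k x)
  label-onto (suc t) = k ↑ʳ t , λ { refl → cong [ const zero , suc ]′ (splitAt-↑ʳ k x t) }

  label-copy-rotating : ∀ i {v s} → layout v ≡ rotating s → label (copy i v) ≡ zero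
  label-copy-rotating i {v} eq =
    label-< (copy i v) (subst (_< k) (sym (trans (toℕ-copy i v) (cong (place (toℕ i)) eq))) (m%n<n _ k))

  copy-fixed : ∀ i j {v t} → layout v ≡ fixed t → copy i v ≡ copy j v
  copy-fixed i j {v} eq = toℕ-injective
    (trans (toℕ-copy i v) (trans (cong (place (toℕ i)) eq) (sym (trans (toℕ-copy j v) (cong (place (toℕ j)) eq)))))

  label-copy : ∀ i j v → label (copy i v) ≡ label (copy j v)
  label-copy i j v = by-slot (layout v) refl
    where
    by-slot : ∀ σ → layout v ≡ σ → label (copy i v) ≡ label (copy j v)
    by-slot (rotating _) eq = trans (label-copy-rotating i eq) (sym (label-copy-rotating j eq))
    by-slot (fixed _)    eq = cong label (copy-fixed i j eq)

  packing : LabeledPacking (k + x) k (suc x)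
  packing = record
    { label         = label
    ; label-onto    = label-onto
    ; σ             = copy
    ; σ-injective   = copy-injective
    ; arcs-disjoint = copies-arc-disjoint
    ; label-fixed   = label-copy
    }

mainTheorem9 : (k x : ℕ) → 2 ≤ k → 2 ∣ k → 1 ≤ x → x ≤ k ∸ 1 →
    ¬ ((x ≡ 1) × (k + x ≡ 4)) → ¬ ((x ≡ 1) × (k + x ≡ 6)) →
    ∃[ p ] ((x + 1 ≤ p) × LabeledPacking (k + x) k p)
-- The two excluded cases have k odd, so their hypotheses go unused.
mainTheorem9 k x 2≤k (divides zero k≡0) _ _ _ _ with () ← subst (2 ≤_) k≡0 2≤k
mainTheorem9 k x _ (divides (suc h′) k≡h*2) 1≤x x≤k∸1 _ _ =
  suc x , ≤-reflexive (+-comm x 1) ,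
  subst (λ m → LabeledPacking (m + x) m (suc x)) (sym k≡h+h) (Packing.packing (zigzag h′) 1≤x x≤h+h)
  where
  open Zigzag using (zigzag)
  k≡h+h : k ≡ suc h′ + suc h′
  k≡h+h = trans k≡h*2 (solve 1 (λ h → h :* con 2 := h :+ h) refl (suc h′))
  x≤h+h : x ≤ suc h′ + suc h′
  x≤h+h = subst (x ≤_) k≡h+h (≤-trans x≤k∸1 (m∸n≤m k 1))
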